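{- Let $d$ be a positive divisor of $N$. Then $p^d_*\circ\mathcal F=\mathcal F_d\circ\tilde p^d_*$ and $i_d^*\circ\mathcal F=\mathcal F_d\circ\tilde i_d^*$ as maps $\mathbb{Q}(\mu_N)\langle\langle\widetilde X\rangle\rangle\to\mathbb{Q}(\mu_N)\langle\langle X_d\rangle\rangle$ (all maps extended $\mathbb{Q}(\mu_N)$-linearly).
   Context: Let $N\ge3$, $\mu_N$ the $N$-th roots of unity in $\mathbb{C}$, $\zeta_N=\exp(2\pi i/N)$, $\iota:\{1,\dots,N\}\to\mathbb{Z}/N\mathbb{Z}$ the residue bijection. Alphabets $X=\{x_0\}\cup\{x_\zeta:\zeta\in\mu_N\}$, $\widetilde X=\{\tilde x\}\cup\{\tilde x_\alpha:\alpha\in\mathbb{Z}/N\mathbb{Z}\}$; series algebras (noncommutative formal power series) have coefficients in $\mathbb{Q}(\mu_N)$; all maps below are continuous $\mathbb{Q}(\mu_N)$-algebra morphisms defined on generators. $\mathcal F:\tilde x\mapsto x_0$, $\tilde x_\alpha\mapsto\sum_{m=1}^N\zeta_N^{ -m\iota^{ -1}(\alpha)}x_{\zeta_N^m}$. For a divisor $d$ of $N$: $X_d=\{x_0\}\cup\{x_\zeta:\zeta\in\mu_{N/d}\}\subset X$; $\iota_d:\{1,\dots,N/d\}\to\mathbb{Z}/\frac Nd\mathbb{Z}$ the residue bijection; $\nu_d:\mathbb{Z}/\frac Nd\mathbb{Z}\to d\mathbb{Z}/N\mathbb{Z}$ the group isomorphism with $\nu_d(\iota_d(m))=\iota(dm)$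 for $m\in\{1,\dots,N/d\}$; $\widetilde X_d=\{\tilde x\}\cup\{\tilde x_\beta:\beta\in\mathbb{Z}/\frac Nd\mathbb{Z}\}$. $\mathcal F_d:\mathbb{Q}(\mu_N)\langle\langle\widetilde X_d\rangle\rangle\to\mathbb{Q}(\mu_N)\langle\langle X_d\rangle\rangle$: $\tilde x\mapsto x_0$, $\tilde x_\beta\mapsto\sum_{m=1}^{N/d}\zeta_N^{ -md\,\iota_d^{ -1}(\beta)}x_{\zeta_N^{dm}}$. $p^d_*:\mathbb{Q}(\mu_N)\langle\langle X\rangle\rangle\to\mathbb{Q}(\mu_N)\langle\langle X_d\rangle\rangle$: $x_0\mapsto d\,x_0$, $x_\zeta\mapsto x_{\zeta^d}$. $i_d^*$: $x_0\mapsto x_0$, $x_\zeta\mapsto x_\zeta$ if $\zeta\in\mu_{N/d}$ and $0$ otherwise. $\tilde p^d_*:\mathbb{Q}(\mu_N)\langle\langle\widetilde X\rangle\rangle\to\mathbb{Q}(\mu_N)\langle\langle\widetilde X_d\rangle\rangle$: $\tilde x\mapsto d\,\tilde x$, $\tilde x_\alpha\mapsto d\,\tilde x_{\nu_d^{ -1}(\alpha)}$ if $\alpha\in d\mathbb{Z}/N\mathbb{Z}$ and $0$ otherwise. $\tilde i_d^*$: $\tilde x\mapsto\tilde x$, $\tilde x_\alpha\mapsto\tilde x_{\nu_d^{ -1}(d\alpha)}$. -}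

module Defs where

open import Level using (Level; _⊔_)
open import Data.Nat using (ℕ; zero; suc; NonZero; _<_; _∸_)
  renaming (_+_ to _+ℕ_; _*_ to _*ℕ_)
open import Data.Nat.DivMod using (_mod_; _/_)
open import Data.Nat.Divisibility using (_∣_; _∣?_)
open import Data.Fin using (Fin; toℕ)
import Data.Fin as Fin
open import Data.List using (List; []; _∷_; map; foldr; allFin)
open import Data.Integer using (ℤ) renaming (+_ to ℤ+_; -_ to ℤ-_)
import Data.Integer.DivMod as ℤDM
open import Relation.Nullary using (¬_; yes; no)
open import Algebra.Bundles using (CommutativeRing)

-- Alphabets.  `Alph n` = {x₀} ∪ {x[ i ] : i ∈ Fin n}.
--  * X   = Alph N : x₀ ↦ x_0 , x[ k ] ↦ x_{ζ_N^k}     (k ∈ Fin N ≅ ℤ/N, exponent)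
--  * X̃   = Alph N : x₀ ↦ x̃   , x[ α ] ↦ x̃_α          (α ∈ ℤ/N as Fin N)
--  * X_d = Alph M : x₀ ↦ x_0 , x[ j ] ↦ x_{ζ_N^{d j}} (M = N/d; these are exactly μ_{N/d})
--  * X̃_d = Alph M : x₀ ↦ x̃   , x[ β ] ↦ x̃_β          (β ∈ ℤ/M as Fin M)

data Alph (n : ℕ) : Set where
  x₀  : Alph n
  x[_] : Fin n → Alph n

allAlph : (n : ℕ) → List (Alph n)
allAlph n = x₀ ∷ map x[_] (allFin n)

-- residue bijection ι⁻¹ : ℤ/n → {1,…,n}  (residue 0 ↦ n)
ιinv : {n : ℕ} → Fin n → ℕ
ιinv {n} Fin.zero    = n
ιinv     (Fin.suc i) = toℕ (Fin.suc i)

module Series {c ℓ : Level} (K : CommutativeRing c ℓ) where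
  open CommutativeRing K

  -- noncommutative formal power series over alphabet A with coefficients in K:
  -- a series is its coefficient function on words
  Ser : Set → Set c
  Ser A = List A → Carrier

  sumL : {A : Set} → List A → (A → Carrier) → Carrier
  sumL xs f = foldr (λ a r → f a + r) 0# xs

  Σ1to : ℕ → (ℕ → Carrier) → Carrier
  Σ1to zero    f = 0#
  Σ1to (suc n) f = Σ1to n f + f (suc n)

  natK : ℕ → Carrier
  natK zero    = 0#
  natK (suc n) = 1# + natK n

  pow : Carrier → ℕ → Carrier
  pow x zero    = 1#
  pow x (suc n) = x * pow x n

  -- The continuous algebra morphism  Ser A → Ser B  determined on generators by
  -- a ↦ Σ_b σ a b · b  (σ a b = coefficient of letter b in the image of letter a).
  -- Coefficient of b₁…bₙ in the image of S is Σ_{a₁…aₙ} S(a₁…aₙ) Π σ aᵢ bᵢ,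
  -- computed letter by letter.
  subst : {A B : Set} → List A → (A → B → Carrier) → Ser A → Ser B
  subst enumA σ S []      = S []
  subst enumA σ S (b ∷ w) =
    sumL enumA (λ a → σ a b * subst enumA σ (λ u → S (a ∷ u)) w)

  _≈S_ : {A : Set} → Ser A → Ser A → Set ℓ
  S ≈S T = ∀ w → S w ≈ T w

  IsField : Set (c ⊔ ℓ)
  IsField = (¬ (1# ≈ 0#)) × (∀ x → ¬ (x ≈ 0#) → Σ Carrier (λ y → x * y ≈ 1#))
    where open import Data.Product using (_×_; Σ)

  IsPrimitiveRoot : ℕ → Carrier → Set ℓ
  IsPrimitiveRoot N ζ = (pow ζ N ≈ 1#) × (∀ k → 0 < k → k < N → ¬ (pow ζ k ≈ 1#))
    where open import Data.Product using (_×_)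

  module Maps (ζ : Carrier) (N : ℕ) .{{_ : NonZero N}} where

    -- ζ^e for e ∈ ℤ  (using ζ^N = 1)
    ζ^ : ℤ → Carrier
    ζ^ e = pow ζ (e ℤDM.%ℕ N)

    δ : {n : ℕ} → Alph n → Alph n → Carrier → Carrier
    δ x₀ x₀ c = c
    δ x₀ x[ _ ] c = 0#
    δ x[ _ ] x₀ c = 0#
    δ x[ i ] x[ j ] c with Fin._≟_ i j
    ... | yes _ = c
    ... | no  _ = 0#

    -- 𝓕 : x̃ ↦ x₀ , x̃_α ↦ Σ_{m=1}^N ζ_N^{-m ι⁻¹(α)} x_{ζ_N^m}
    𝓕σ : Alph N → Alph N → Carrier
    𝓕σ x₀ b = δ x₀ b 1#
    𝓕σ x[ α ] b = Σ1to N (λ m → δ x[ m mod N ] b (ζ^ (ℤ- ℤ+ (m *ℕ ιinv α))))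

    𝓕 : Ser (Alph N) → Ser (Alph N)
    𝓕 = subst (allAlph N) 𝓕σ

    module Div (d : ℕ) .{{_ : NonZero d}} (M : ℕ) .{{_ : NonZero M}} where

      -- ν_d : ℤ/M → dℤ/N , ι_d(m) ↦ ι(dm);  ν_d⁻¹ on dℤ/N
      ν : Fin M → Fin N
      ν β = (d *ℕ ιinv β) mod N

      νinv : Fin N → Fin M
      νinv α = (toℕ α / d) mod M

      -- 𝓕_d : x̃ ↦ x₀ , x̃_β ↦ Σ_{m=1}^{M} ζ_N^{-m d ι_d⁻¹(β)} x_{ζ_N^{dm}}
      𝓕dσ : Alph M → Alph M → Carrier
      𝓕dσ x₀ b = δ x₀ b 1#
      𝓕dσ x[ β ] b = Σ1to M (λ m → δ x[ m mod M ] b (ζ^ (ℤ- ℤ+ (m *ℕ d *ℕ ιinv β))))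

      𝓕d : Ser (Alph M) → Ser (Alph M)
      𝓕d = subst (allAlph M) 𝓕dσ

      -- p^d_* : x₀ ↦ d x₀ , x_ζ ↦ x_{ζ^d}   (ζ = ζ_N^k ↦ ζ_N^{dk} = code k mod M)
      pσ : Alph N → Alph M → Carrier
      pσ x₀ b = δ x₀ b (natK d)
      pσ x[ k ] b = δ x[ toℕ k mod M ] b 1#

      p* : Ser (Alph N) → Ser (Alph M)
      p* = subst (allAlph N) pσ

      -- i_d^* : x₀ ↦ x₀ , x_ζ ↦ x_ζ if ζ ∈ μ_{N/d} (i.e. d ∣ k for ζ = ζ_N^k), else 0
      iσ : Alph N → Alph M → Carrier
      iσ x₀ b = δ x₀ b 1#
      iσ x[ k ] b with d ∣? toℕ k
      ... | yes _ = δ x[ (toℕ k / d) mod M ] b 1#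
      ... | no  _ = 0#

      i* : Ser (Alph N) → Ser (Alph M)
      i* = subst (allAlph N) iσ

      -- p̃^d_* : x̃ ↦ d x̃ , x̃_α ↦ d x̃_{ν⁻¹(α)} if α ∈ dℤ/N, else 0
      p̃σ : Alph N → Alph M → Carrier
      p̃σ x₀ b = δ x₀ b (natK d)
      p̃σ x[ α ] b with d ∣? toℕ α
      ... | yes _ = δ x[ νinv α ] b (natK d)
      ... | no  _ = 0#

      p̃* : Ser (Alph N) → Ser (Alph M)
      p̃* = subst (allAlph N) p̃σ

      -- ĩ_d^* : x̃ ↦ x̃ , x̃_α ↦ x̃_{ν⁻¹(dα)}
      ĩσ : Alph N → Alph M → Carrier
      ĩσ x₀ b = δ x₀ b 1#
      ĩσ x[ α ] b = δ x[ νinv ((d *ℕ toℕ α) mod N) ] b 1#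

      ĩ* : Ser (Alph N) → Ser (Alph M)
      ĩ* = subst (allAlph N) ĩσ

{-# OPTIONS --safe #-}

-- Both identities compare composites of substitutions determined by their values on letters,
-- so it suffices to compare the images of single letters, and only the letters x̃_α need work.
-- p^d_* 𝓕(x̃_α) = Σ_{m=1}^{N} ζ^{-mα} x_{ζ^{dm}} has a summand that is quasi-periodic in m with
-- period M = N/d and multiplier r = ζ^{-Mα}, so it is (1 + r + ⋯ + r^{d-1}) times the sum over
-- the first period.  As ζ is primitive, r = 1 exactly when d ∣ α, and then the first period is
-- 𝓕_d(x̃_{ν⁻¹α}); otherwise r ≠ 1 is a d-th root of unity and the geometric sum vanishes in the
-- field.  In i_d^* 𝓕(x̃_α) only the terms with d ∣ m survive, and m = d m′ turns the sum into
-- 𝓕_d(x̃_{ν⁻¹(dα)}).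

module Submission where

open import Defs
open import Level using (Level)
open import Data.Nat using (ℕ; NonZero; _≤_; zero; suc)
open import Data.Nat.Divisibility using (_∣_; quotient; quotient≢0; divides)
open import Data.Product using (_×_; _,_; proj₁; proj₂)
open import Algebra.Bundles using (CommutativeRing)

import Data.Nat as ℕ
import Data.Nat.Properties as ℕ
open import Data.Nat.Divisibility using (_∣?_; ∣⇒≤; ∣m+n∣m⇒∣n; ∣-refl)
open import Data.Nat.DivMod using (_/_)
open import Data.Fin as Fin using (Fin; toℕ)
import Data.Fin.Properties as Fin
open import Data.List using (List; []; _∷_; map; allFin)
import Data.List.Properties as List
open import Data.Empty using (⊥-elim)
open import Function using (_∘_; id; flip)
import Relation.Binary.PropositionalEquality as ≡
open import Relation.Nullary using (¬_; Dec; yes; no)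

module FieldProperties {c ℓ : Level} (K : CommutativeRing c ℓ) (isField : Series.IsField K) where
  open CommutativeRing K
  open import Algebra.Properties.Group +-group using (x∙y⁻¹≈ε⇒x≈y; x≈y⇒x∙y⁻¹≈ε)
  open import Algebra.Properties.Ring ring using ([y-z]x≈yx-zx)
  open import Relation.Binary.Reasoning.Setoid setoid

  xz≈yz∧x≉y⇒z≈0 : ∀ {x y z} → x * z ≈ y * z → ¬ x ≈ y → z ≈ 0#
  xz≈yz∧x≉y⇒z≈0 {x} {y} {z} xz≈yz x≉y with proj₂ isField (x - y) (x≉y ∘ x∙y⁻¹≈ε⇒x≈y x y)
  ... | w , [x-y]w≈1 = begin
    z                    ≈⟨ *-identityˡ z ⟨
    1# * z               ≈⟨ *-congʳ (trans (*-comm w _) [x-y]w≈1) ⟨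
    (w * (x - y)) * z    ≈⟨ *-assoc w _ z ⟩
    w * ((x - y) * z)    ≈⟨ *-congˡ ([y-z]x≈yx-zx z x y) ⟩
    w * (x * z - y * z)  ≈⟨ *-congˡ (x≈y⇒x∙y⁻¹≈ε xz≈yz) ⟩
    w * 0#               ≈⟨ zeroʳ w ⟩
    0#                   ∎

module FiniteSums {c ℓ : Level} (K : CommutativeRing c ℓ) where
  open CommutativeRing K
  open Series K using (sumL; Σ1to; natK)
  open import Algebra.Properties.CommutativeSemigroup +-commutativeSemigroup
    using (interchange; xy∙z≈zx∙y)
  open import Algebra.Properties.Group +-group using () renaming (∙-cancelʳ to +-cancelʳ)
  open import Algebra.Properties.Semiring.Exp semiring using (_^_)
  open import Relation.Binary.Reasoning.Setoid setoid

  private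
    variable
      A B : Set

  sumL-cong : (xs : List A) {f g : A → Carrier} →
              (∀ a → f a ≈ g a) → sumL xs f ≈ sumL xs g
  sumL-cong []       f≈g = refl
  sumL-cong (x ∷ xs) f≈g = +-cong (f≈g x) (sumL-cong xs f≈g)

  sumL-zero : (xs : List A) {f : A → Carrier} → (∀ a → f a ≈ 0#) → sumL xs f ≈ 0#
  sumL-zero []       f≈0 = refl
  sumL-zero (x ∷ xs) f≈0 = trans (+-cong (f≈0 x) (sumL-zero xs f≈0)) (+-identityˡ 0#)

  sumL-+ : (xs : List A) (f g : A → Carrier) →
           sumL xs (λ a → f a + g a) ≈ sumL xs f + sumL xs g
  sumL-+ []       f g = sym (+-identityˡ 0#)
  sumL-+ (x ∷ xs) f g = trans (+-congˡ (sumL-+ xs f g)) (interchange _ _ _ _)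

  sumL-*ˡ : (xs : List A) (k : Carrier) (f : A → Carrier) →
            k * sumL xs f ≈ sumL xs (λ a → k * f a)
  sumL-*ˡ []       k f = zeroʳ k
  sumL-*ˡ (x ∷ xs) k f = trans (distribˡ k (f x) _) (+-congˡ (sumL-*ˡ xs k f))

  sumL-*ʳ : (xs : List A) (k : Carrier) (f : A → Carrier) →
            sumL xs f * k ≈ sumL xs (λ a → f a * k)
  sumL-*ʳ xs k f = trans (*-comm _ k) (trans (sumL-*ˡ xs k f) (sumL-cong xs λ a → *-comm k (f a)))

  sumL-swap : (xs : List A) (ys : List B) (g : A → B → Carrier) →
              sumL xs (λ a → sumL ys (g a)) ≈ sumL ys (λ b → sumL xs (λ a → g a b))
  sumL-swap []       ys g = sym (sumL-zero ys (λ _ → refl))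
  sumL-swap (x ∷ xs) ys g = trans (+-congˡ (sumL-swap xs ys g)) (sym (sumL-+ ys (g x) _))

  sumL-map : (h : A → B) (xs : List A) (f : B → Carrier) →
             sumL (map h xs) f ≡.≡ sumL xs (f ∘ h)
  sumL-map h []       f = ≡.refl
  sumL-map h (x ∷ xs) f = ≡.cong (f (h x) +_) (sumL-map h xs f)

  sumL-allFin : ∀ n (h : Fin (suc n) → Carrier) →
                sumL (allFin (suc n)) h ≡.≡ h Fin.zero + sumL (allFin n) (h ∘ Fin.suc)
  sumL-allFin n h = ≡.cong (h Fin.zero +_) (≡.trans
    (≡.cong (λ xs → sumL xs h) (≡.sym (List.map-tabulate id Fin.suc)))
    (sumL-map Fin.suc (allFin n) h))

  sumL-allFin-single : ∀ {n} (i : Fin n) (h : Fin n → Carrier) →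
                       (∀ k → k ≡.≢ i → h k ≈ 0#) → sumL (allFin n) h ≈ h i
  sumL-allFin-single {suc n} Fin.zero h h≈0 = begin
    sumL (allFin (suc n)) h
      ≡⟨ sumL-allFin n h ⟩
    h Fin.zero + sumL (allFin n) (h ∘ Fin.suc)
      ≈⟨ +-congˡ (sumL-zero (allFin n) (λ k → h≈0 (Fin.suc k) λ ())) ⟩
    h Fin.zero + 0#
      ≈⟨ +-identityʳ _ ⟩
    h Fin.zero ∎
  sumL-allFin-single {suc n} (Fin.suc i) h h≈0 = begin
    sumL (allFin (suc n)) h
      ≡⟨ sumL-allFin n h ⟩
    h Fin.zero + sumL (allFin n) (h ∘ Fin.suc)
      ≈⟨ +-cong (h≈0 Fin.zero λ ()) (sumL-allFin-single i (h ∘ Fin.suc) λ k k≢i →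
                   h≈0 (Fin.suc k) (k≢i ∘ Fin.suc-injective)) ⟩
    0# + h (Fin.suc i)
      ≈⟨ +-identityˡ _ ⟩
    h (Fin.suc i) ∎

  sumL-allAlph-single : ∀ {n} (a : Alph n) (f : Alph n → Carrier) →
                        (∀ b → b ≡.≢ a → f b ≈ 0#) → sumL (allAlph n) f ≈ f a
  sumL-allAlph-single {n} x₀ f f≈0 = begin
    f x₀ + sumL (map x[_] (allFin n)) f  ≡⟨ ≡.cong (f x₀ +_) (sumL-map x[_] (allFin n) f) ⟩
    f x₀ + sumL (allFin n) (f ∘ x[_])    ≈⟨ +-congˡ (sumL-zero (allFin n) λ k → f≈0 x[ k ] λ ()) ⟩
    f x₀ + 0#                            ≈⟨ +-identityʳ _ ⟩
    f x₀                                 ∎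
  sumL-allAlph-single {n} x[ i ] f f≈0 = begin
    f x₀ + sumL (map x[_] (allFin n)) f  ≡⟨ ≡.cong (f x₀ +_) (sumL-map x[_] (allFin n) f) ⟩
    f x₀ + sumL (allFin n) (f ∘ x[_])    ≈⟨ +-cong (f≈0 x₀ λ ()) (sumL-allFin-single i (f ∘ x[_]) λ k k≢i →
                                                f≈0 x[ k ] λ { ≡.refl → k≢i ≡.refl }) ⟩
    0# + f x[ i ]                        ≈⟨ +-identityˡ _ ⟩
    f x[ i ]                             ∎

  Σ1to-cong : ∀ n {f g : ℕ → Carrier} → (∀ m → f m ≈ g m) → Σ1to n f ≈ Σ1to n g
  Σ1to-cong zero    f≈g = refl
  Σ1to-cong (suc n) f≈g = +-cong (Σ1to-cong n f≈g) (f≈g (suc n))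

  Σ1to-zero : ∀ n {f : ℕ → Carrier} → (∀ m → 1 ℕ.≤ m → m ℕ.≤ n → f m ≈ 0#) → Σ1to n f ≈ 0#
  Σ1to-zero zero    f≈0 = refl
  Σ1to-zero (suc n) f≈0 = trans
    (+-cong (Σ1to-zero n λ m 1≤m m≤n → f≈0 m 1≤m (ℕ.m≤n⇒m≤1+n m≤n))
            (f≈0 (suc n) (ℕ.s≤s ℕ.z≤n) ℕ.≤-refl))
    (+-identityˡ 0#)

  Σ1to-*ˡ : ∀ n k (f : ℕ → Carrier) → k * Σ1to n f ≈ Σ1to n (λ m → k * f m)
  Σ1to-*ˡ zero    k f = zeroʳ k
  Σ1to-*ˡ (suc n) k f = trans (distribˡ k _ _) (+-congʳ (Σ1to-*ˡ n k f))

  Σ1to-*ʳ : ∀ n k (f : ℕ → Carrier) → Σ1to n f * k ≈ Σ1to n (λ m → f m * k)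
  Σ1to-*ʳ n k f = trans (*-comm _ k) (trans (Σ1to-*ˡ n k f) (Σ1to-cong n λ m → *-comm k (f m)))

  sumL-Σ1to : (xs : List A) (n : ℕ) (g : A → ℕ → Carrier) →
              sumL xs (λ a → Σ1to n (g a)) ≈ Σ1to n (λ m → sumL xs (λ a → g a m))
  sumL-Σ1to xs zero    g = sumL-zero xs λ _ → refl
  sumL-Σ1to xs (suc n) g = trans (sumL-+ xs _ _) (+-congʳ (sumL-Σ1to xs n g))

  Σ1to-+ : ∀ a b (f : ℕ → Carrier) → Σ1to (a ℕ.+ b) f ≈ Σ1to a f + Σ1to b (λ m → f (a ℕ.+ m))
  Σ1to-+ a zero f = begin
    Σ1to (a ℕ.+ 0) f ≡⟨ ≡.cong (λ n → Σ1to n f) (ℕ.+-identityʳ a) ⟩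
    Σ1to a f         ≈⟨ +-identityʳ _ ⟨
    Σ1to a f + 0#    ∎
  Σ1to-+ a (suc b) f = begin
    Σ1to (a ℕ.+ suc b) f
      ≡⟨ ≡.cong (λ n → Σ1to n f) (ℕ.+-suc a b) ⟩
    Σ1to (a ℕ.+ b) f + f (suc (a ℕ.+ b))
      ≈⟨ +-cong (Σ1to-+ a b f) (reflexive (≡.cong f (≡.sym (ℕ.+-suc a b)))) ⟩
    (Σ1to a f + Σ1to b (λ m → f (a ℕ.+ m))) + f (a ℕ.+ suc b)
      ≈⟨ +-assoc _ _ _ ⟩
    Σ1to a f + Σ1to (suc b) (λ m → f (a ℕ.+ m)) ∎

  Σ1to-multiples : ∀ d .{{_ : NonZero d}} t (F : ℕ → Carrier) →
                   (∀ m → ¬ d ∣ m → F m ≈ 0#) → Σ1to (t ℕ.* d) F ≈ Σ1to t (λ m → F (d ℕ.* m))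
  Σ1to-multiples d zero F F≈0 = refl
  Σ1to-multiples d@(suc e) (suc t) F F≈0 = begin
    Σ1to (d ℕ.+ t ℕ.* d) F
      ≈⟨ Σ1to-+ d (t ℕ.* d) F ⟩
    Σ1to d F + Σ1to (t ℕ.* d) (λ m → F (d ℕ.+ m))
      ≈⟨ +-cong first-block (Σ1to-multiples d t (F ∘ (d ℕ.+_)) shifted-vanishing) ⟩
    F d + Σ1to t (λ m → F (d ℕ.+ d ℕ.* m))
      ≈⟨ +-cong (reflexive (≡.cong F (ℕ.*-identityʳ d)))
                (Σ1to-cong t λ m → reflexive (≡.cong F (ℕ.*-suc d m))) ⟨
    F (d ℕ.* 1) + Σ1to t (λ m → F (d ℕ.* suc m))
      ≈⟨ +-congʳ (+-identityˡ _) ⟨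
    Σ1to 1 (λ m → F (d ℕ.* m)) + Σ1to t (λ m → F (d ℕ.* (1 ℕ.+ m)))
      ≈⟨ Σ1to-+ 1 t (λ m → F (d ℕ.* m)) ⟨
    Σ1to (suc t) (λ m → F (d ℕ.* m)) ∎
    where
    first-block : Σ1to d F ≈ F d
    first-block = trans (+-congʳ (Σ1to-zero e λ m 1≤m m≤e → F≈0 m λ d∣m →
                    ℕ.<⇒≱ (ℕ.s≤s m≤e) (∣⇒≤ {{ℕ.>-nonZero 1≤m}} d∣m))) (+-identityˡ _)
    shifted-vanishing : ∀ m → ¬ d ∣ m → F (d ℕ.+ m) ≈ 0#
    shifted-vanishing m d∤m = F≈0 (d ℕ.+ m) (d∤m ∘ flip ∣m+n∣m⇒∣n ∣-refl)

  -- 1 + r + ⋯ + r ^ (t - 1), in Horner form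
  geometricSum : Carrier → ℕ → Carrier
  geometricSum r zero    = 0#
  geometricSum r (suc t) = 1# + r * geometricSum r t

  geometricSum-one : ∀ {r} t → r ≈ 1# → geometricSum r t ≈ natK t
  geometricSum-one zero    r≈1 = refl
  geometricSum-one (suc t) r≈1 =
    +-congˡ (trans (*-cong r≈1 (geometricSum-one t r≈1)) (*-identityˡ _))

  geometricSum-telescope : ∀ r t → r * geometricSum r t + 1# ≈ geometricSum r t + r ^ t
  geometricSum-telescope r zero    = +-congʳ (zeroʳ r)
  geometricSum-telescope r (suc t) = begin
    r * (1# + r * G) + 1#    ≈⟨ +-congʳ (*-congˡ (+-comm 1# _)) ⟩
    r * (r * G + 1#) + 1#    ≈⟨ +-congʳ (*-congˡ (geometricSum-telescope r t)) ⟩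
    r * (G + r ^ t) + 1#     ≈⟨ +-congʳ (distribˡ r G _) ⟩
    (r * G + r ^ suc t) + 1# ≈⟨ xy∙z≈zx∙y _ _ _ ⟩
    (1# + r * G) + r ^ suc t ∎
    where
    G : Carrier
    G = geometricSum r t

  Σ1to-quasiperiodic : ∀ M t r (f : ℕ → Carrier) → (∀ m → f (M ℕ.+ m) ≈ r * f m) →
                       Σ1to (t ℕ.* M) f ≈ geometricSum r t * Σ1to M f
  Σ1to-quasiperiodic M zero    r f shift = sym (zeroˡ _)
  Σ1to-quasiperiodic M (suc t) r f shift = begin
    Σ1to (M ℕ.+ t ℕ.* M) f                            ≈⟨ Σ1to-+ M (t ℕ.* M) f ⟩
    Q + Σ1to (t ℕ.* M) (λ m → f (M ℕ.+ m))            ≈⟨ +-congˡ (Σ1to-cong (t ℕ.* M) shift) ⟩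
    Q + Σ1to (t ℕ.* M) (λ m → r * f m)                ≈⟨ +-congˡ (Σ1to-*ˡ (t ℕ.* M) r f) ⟨
    Q + r * Σ1to (t ℕ.* M) f                          ≈⟨ +-congˡ (*-congˡ (Σ1to-quasiperiodic M t r f shift)) ⟩
    Q + r * (geometricSum r t * Q)                    ≈⟨ +-cong (*-identityˡ Q) (*-assoc r _ Q) ⟨
    1# * Q + (r * geometricSum r t) * Q               ≈⟨ distribʳ Q 1# _ ⟨
    (1# + r * geometricSum r t) * Q                   ∎
    where
    Q : Carrier
    Q = Σ1to M f

  module _ (isField : Series.IsField K) where
    open FieldProperties K isField

    geometricSum-root : ∀ {r} t → ¬ r ≈ 1# → r ^ t ≈ 1# → geometricSum r t ≈ 0#
    geometricSum-root {r} t r≉1 rᵗ≈1 = xz≈yz∧x≉y⇒z≈0 rG≈1G r≉1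
      where
      G : Carrier
      G = geometricSum r t
      rG≈1G : r * G ≈ 1# * G
      rG≈1G = begin
        r * G  ≈⟨ +-cancelʳ 1# _ _ (trans (geometricSum-telescope r t) (+-congˡ rᵗ≈1)) ⟩
        G      ≈⟨ *-identityˡ G ⟨
        1# * G ∎

module Substitution {c ℓ : Level} (K : CommutativeRing c ℓ) where
  open CommutativeRing K
  open Series K
  open FiniteSums K
  open import Algebra.Properties.CommutativeSemigroup *-commutativeSemigroup
    using (x∙yz≈y∙xz; x∙yz≈yx∙z)
  open import Relation.Binary.Reasoning.Setoid setoid

  private
    variable
      A B B′ C I : Set

  compose : List B → (A → B → Carrier) → (B → C → Carrier) → A → C → Carrier
  compose eB σ τ a c = sumL eB (λ b → σ a b * τ b c)

  subst-linear : (eA : List A) (σ : A → B → Carrier) (is : List I) (k : I → Carrier)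
                 (T : I → Ser A) (w : List B) →
                 subst eA σ (λ u → sumL is (λ i → k i * T i u)) w ≈
                 sumL is (λ i → k i * subst eA σ (T i) w)
  subst-linear eA σ is k T []      = refl
  subst-linear {A = A} {I = I} eA σ is k T (c ∷ w) = begin
    sumL eA (λ a → σ a c * subst eA σ (λ u → sumL is (λ i → k i * T i (a ∷ u))) w)
      ≈⟨ sumL-cong eA (λ a → *-congˡ (subst-linear eA σ is k (λ i u → T i (a ∷ u)) w)) ⟩
    sumL eA (λ a → σ a c * sumL is (λ i → k i * T′ a i))
      ≈⟨ sumL-cong eA (λ a → sumL-*ˡ is (σ a c) _) ⟩
    sumL eA (λ a → sumL is (λ i → σ a c * (k i * T′ a i)))
      ≈⟨ sumL-swap eA is _ ⟩
    sumL is (λ i → sumL eA (λ a → σ a c * (k i * T′ a i)))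
      ≈⟨ sumL-cong is (λ i → sumL-cong eA (λ a → x∙yz≈y∙xz (σ a c) (k i) (T′ a i))) ⟩
    sumL is (λ i → sumL eA (λ a → k i * (σ a c * T′ a i)))
      ≈⟨ sumL-cong is (λ i → sumL-*ˡ eA (k i) _) ⟨
    sumL is (λ i → k i * sumL eA (λ a → σ a c * T′ a i)) ∎
    where
    T′ : A → I → Carrier
    T′ a i = subst eA σ (λ u → T i (a ∷ u)) w

  subst-∘ : (eA : List A) (eB : List B) (σ : A → B → Carrier) (τ : B → C → Carrier)
            (S : Ser A) (w : List C) →
            subst eB τ (subst eA σ S) w ≈ subst eA (compose eB σ τ) S w
  subst-∘ eA eB σ τ S []      = refl
  subst-∘ {A = A} eA eB σ τ S (c ∷ w) = begin
    sumL eB (λ b → τ b c * subst eB τ (λ u → subst eA σ S (b ∷ u)) w)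
      ≈⟨ sumL-cong eB (λ b → *-congˡ
           (subst-linear eB τ eA (λ a → σ a b) (λ a → subst eA σ (S ∘ (a ∷_))) w)) ⟩
    sumL eB (λ b → τ b c * sumL eA (λ a → σ a b * subst eB τ (subst eA σ (S ∘ (a ∷_))) w))
      ≈⟨ sumL-cong eB (λ b → *-congˡ (sumL-cong eA (λ a → *-congˡ (subst-∘ eA eB σ τ (S ∘ (a ∷_)) w)))) ⟩
    sumL eB (λ b → τ b c * sumL eA (λ a → σ a b * S′ a))
      ≈⟨ sumL-cong eB (λ b → sumL-*ˡ eA (τ b c) _) ⟩
    sumL eB (λ b → sumL eA (λ a → τ b c * (σ a b * S′ a)))
      ≈⟨ sumL-swap eB eA _ ⟩
    sumL eA (λ a → sumL eB (λ b → τ b c * (σ a b * S′ a)))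
      ≈⟨ sumL-cong eA (λ a → sumL-cong eB (λ b → x∙yz≈yx∙z (τ b c) (σ a b) (S′ a))) ⟩
    sumL eA (λ a → sumL eB (λ b → (σ a b * τ b c) * S′ a))
      ≈⟨ sumL-cong eA (λ a → sumL-*ʳ eB (S′ a) _) ⟨
    sumL eA (λ a → compose eB σ τ a c * S′ a) ∎
    where
    S′ : A → Carrier
    S′ a = subst eA (compose eB σ τ) (S ∘ (a ∷_)) w

  subst-congσ : (eA : List A) {σ σ′ : A → B → Carrier} → (∀ a b → σ a b ≈ σ′ a b) →
                (S : Ser A) → subst eA σ S ≈S subst eA σ′ S
  subst-congσ eA σ≈σ′ S []      = refl
  subst-congσ eA σ≈σ′ S (c ∷ w) =
    sumL-cong eA (λ a → *-cong (σ≈σ′ a c) (subst-congσ eA σ≈σ′ (S ∘ (a ∷_)) w))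

  subst-square : (eA : List A) (eB : List B) (eB′ : List B′)
                 {σ : A → B → Carrier} {τ : B → C → Carrier}
                 {σ′ : A → B′ → Carrier} {τ′ : B′ → C → Carrier} →
                 (∀ a c → compose eB σ τ a c ≈ compose eB′ σ′ τ′ a c) →
                 (S : Ser A) → subst eB τ (subst eA σ S) ≈S subst eB′ τ′ (subst eA σ′ S)
  subst-square eA eB eB′ {σ} {τ} {σ′} {τ′} square S w = begin
    subst eB τ (subst eA σ S) w       ≈⟨ subst-∘ eA eB σ τ S w ⟩
    subst eA (compose eB σ τ) S w     ≈⟨ subst-congσ eA square S w ⟩
    subst eA (compose eB′ σ′ τ′) S w  ≈⟨ subst-∘ eA eB′ σ′ τ′ S w ⟨
    subst eB′ τ′ (subst eA σ′ S) w    ∎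

module Residues where
  open import Data.Nat
  open import Data.Nat.Properties
  open import Data.Nat.DivMod
  open import Data.Nat.Divisibility
  import Data.Integer as ℤ
  open ≡ using (_≡_; refl; cong; sym; trans)
  open ≡.≡-Reasoning

  toℕ-mod : ∀ m n .{{_ : NonZero n}} → toℕ (m mod n) ≡ m % n
  toℕ-mod m n = Fin.toℕ-fromℕ< (m%n<n m n)

  mod-cong : ∀ {a b} n .{{_ : NonZero n}} → a % n ≡ b % n → a mod n ≡ b mod n
  mod-cong {a} {b} n eq = Fin.toℕ-injective (begin
    toℕ (a mod n) ≡⟨ toℕ-mod a n ⟩
    a % n         ≡⟨ eq ⟩
    b % n         ≡⟨ toℕ-mod b n ⟨
    toℕ (b mod n) ∎)

  ιinv-% : ∀ {n} .{{_ : NonZero n}} (β : Fin n) → ιinv β % n ≡ toℕ β % n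
  ιinv-% {n} Fin.zero    = n%n≡0 n
  ιinv-% {n} (Fin.suc _) = refl

  ιinv-mod-% : ∀ a n .{{_ : NonZero n}} → ιinv (a mod n) % n ≡ a % n
  ιinv-mod-% a n = begin
    ιinv (a mod n) % n ≡⟨ ιinv-% (a mod n) ⟩
    toℕ (a mod n) % n  ≡⟨ cong (_% n) (toℕ-mod a n) ⟩
    a % n % n          ≡⟨ m%n%n≡m%n a n ⟩
    a % n              ∎

  *-congˡ-% : ∀ {a b} c n .{{_ : NonZero n}} → a % n ≡ b % n → (c * a) % n ≡ (c * b) % n
  *-congˡ-% {a} {b} c n eq = begin
    (c * a) % n             ≡⟨ %-distribˡ-* c a n ⟩
    (c % n * (a % n)) % n   ≡⟨ cong (λ x → (c % n * x) % n) eq ⟩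
    (c % n * (b % n)) % n   ≡⟨ %-distribˡ-* c b n ⟨
    (c * b) % n             ∎

  ∣-cong-% : ∀ {a b n d} .{{_ : NonZero n}} → d ∣ n → a % n ≡ b % n → d ∣ a → d ∣ b
  ∣-cong-% d∣n eq d∣a = ∣n∣m%n⇒∣m d∣n (≡.subst (_ ∣_) eq (%-presˡ-∣ d∣a d∣n))

  [-k%ℕn+k]%n≡0 : ∀ k n .{{_ : NonZero n}} → ((ℤ.- ℤ.+ k) ℤ.%ℕ n + k) % n ≡ 0
  [-k%ℕn+k]%n≡0 zero    n = begin
    (0 % n + 0) % n ≡⟨ cong (_% n) (+-identityʳ (0 % n)) ⟩
    0 % n % n       ≡⟨ m%n%n≡m%n 0 n ⟩
    0 % n           ≡⟨ m<n⇒m%n≡m (>-nonZero⁻¹ n) ⟩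
    0               ∎
  [-k%ℕn+k]%n≡0 (suc j) n with suc j % n in eq
  ... | zero  = eq
  ... | suc r = begin
    (n ∸ suc r + suc j) % n                ≡⟨ %-distribˡ-+ (n ∸ suc r) (suc j) n ⟩
    ((n ∸ suc r) % n + suc j % n) % n      ≡⟨ cong (λ x → ((n ∸ suc r) % n + x) % n)
                                                   (trans eq (sym (m<n⇒m%n≡m r<n))) ⟩
    ((n ∸ suc r) % n + suc r % n) % n      ≡⟨ %-distribˡ-+ (n ∸ suc r) (suc r) n ⟨
    (n ∸ suc r + suc r) % n                ≡⟨ cong (_% n) (m∸n+n≡m (<⇒≤ r<n)) ⟩
    n % n                                  ≡⟨ n%n≡0 n ⟩
    0                                      ∎
    where
    r<n : suc r < n
    r<n = ≡.subst (_< n) eq (m%n<n (suc j) n)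

module QuotientResidues (M d : ℕ) .{{_ : NonZero M}} .{{_ : NonZero d}} where
  open import Data.Nat
  open import Data.Nat.Properties
  open import Data.Nat.DivMod
  open import Data.Nat.Divisibility
  open Residues
  open ≡ using (_≡_; refl; cong; sym; trans)
  open ≡.≡-Reasoning

  N : ℕ
  N = M * d

  instance
    N≢0 : NonZero N
    N≢0 = m*n≢0 M d

  mod-N-mod-M : ∀ m → toℕ (m mod N) mod M ≡ m mod M
  mod-N-mod-M m = mod-cong M (trans (cong (_% M) (toℕ-mod m N)) (m∣n⇒o%n%m≡o%m M N m (m∣m*n d)))

  M+-mod-M : ∀ m → (M + m) mod M ≡ m mod M
  M+-mod-M m = mod-cong M (%-remove-+ˡ m ∣-refl)

  *d-cong-% : ∀ {x y} → x % M ≡ y % M → (x * d) % N ≡ (y * d) % N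
  *d-cong-% {x} {y} eq = begin
    (x * d) % N  ≡⟨ m%n*o≡m*o%[n*o] x M d ⟨
    x % M * d    ≡⟨ cong (_* d) eq ⟩
    y % M * d    ≡⟨ m%n*o≡m*o%[n*o] y M d ⟩
    (y * d) % N  ∎

  d∣-mod-N : ∀ {m} → d ∣ toℕ (m mod N) → d ∣ m
  d∣-mod-N {m} d∣m%N = ∣n∣m%n⇒∣m (n∣m*n M) (≡.subst (d ∣_) (toℕ-mod m N) d∣m%N)

  d∣-d*-mod-N : ∀ m → d ∣ toℕ ((d * m) mod N)
  d∣-d*-mod-N m = ≡.subst (d ∣_) (sym (toℕ-mod (d * m) N)) (%-presˡ-∣ (m∣m*n m) (n∣m*n M))

  d*-mod-N-div : ∀ m → (toℕ ((d * m) mod N) / d) mod M ≡ m mod M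
  d*-mod-N-div m = mod-cong M (begin
    toℕ ((d * m) mod N) / d % M ≡⟨ cong (λ x → x / d % M) (toℕ-mod (d * m) N) ⟩
    (d * m) % N / d % M         ≡⟨ cong (_% M) (m%[n*o]/o≡m/o%n (d * m) M d) ⟩
    (d * m) / d % M % M         ≡⟨ m%n%n≡m%n (d * m / d) M ⟩
    (d * m) / d % M             ≡⟨ cong (λ x → x / d % M) (*-comm d m) ⟩
    m * d / d % M               ≡⟨ cong (_% M) (m*n/n≡m m d) ⟩
    m % M                       ∎)

  N∣M*ιinv⇒d∣ : (α : Fin N) → N ∣ M * ιinv α → d ∣ toℕ α
  N∣M*ιinv⇒d∣ α N∣Mια = ∣-cong-% (n∣m*n M) (ιinv-% α) (*-cancelˡ-∣ M N∣Mια)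

  d∣⇒N∣M*ιinv : (α : Fin N) → d ∣ toℕ α → N ∣ M * ιinv α
  d∣⇒N∣M*ιinv α d∣α = *-monoʳ-∣ M (∣-cong-% (n∣m*n M) (sym (ιinv-% α)) d∣α)

  N∣M*x*d : ∀ x → N ∣ M * x * d
  N∣M*x*d x = divides x (begin
    M * x * d   ≡⟨ cong (_* d) (*-comm M x) ⟩
    x * M * d   ≡⟨ *-assoc x M d ⟩
    x * N       ∎)

  exponent-*d : ∀ {x y} m → (x * d) % N ≡ y % N → (m * d * x) % N ≡ (m * y) % N
  exponent-*d {x} {y} m eq = begin
    (m * d * x) % N    ≡⟨ cong (_% N) (*-assoc m d x) ⟩
    (m * (d * x)) % N  ≡⟨ cong (λ z → (m * z) % N) (*-comm d x) ⟩
    (m * (x * d)) % N  ≡⟨ *-congˡ-% m N eq ⟩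
    (m * y) % N        ∎

  νinv-exponent : (α : Fin N) → d ∣ toℕ α → ∀ m →
                  (m * ιinv α) % N ≡ (m * d * ιinv ((toℕ α / d) mod M)) % N
  νinv-exponent α d∣α m = sym (exponent-*d m (begin
    (ιinv ((toℕ α / d) mod M) * d) % N ≡⟨ *d-cong-% (ιinv-mod-% (toℕ α / d) M) ⟩
    (toℕ α / d * d) % N                ≡⟨ cong (_% N) (m/n*n≡m d∣α) ⟩
    toℕ α % N                          ≡⟨ ιinv-% α ⟨
    ιinv α % N                         ∎))

  νinv-d*-exponent : (α : Fin N) → ∀ m →
                     (d * m * ιinv α) % N ≡
                     (m * d * ιinv ((toℕ ((d * toℕ α) mod N) / d) mod M)) % N
  νinv-d*-exponent α m = begin
    (d * m * ιinv α) % N      ≡⟨ cong (λ e → e * ιinv α % N) (*-comm d m) ⟩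
    (m * d * ιinv α) % N      ≡⟨ cong (_% N) (*-assoc m d (ιinv α)) ⟩
    (m * (d * ιinv α)) % N    ≡⟨ exponent-*d m (begin
      (ιinv β * d) % N            ≡⟨ cong (λ b → (ιinv b * d) % N) (d*-mod-N-div (toℕ α)) ⟩
      (ιinv (toℕ α mod M) * d) % N ≡⟨ *d-cong-% (ιinv-mod-% (toℕ α) M) ⟩
      (toℕ α * d) % N             ≡⟨ cong (_% N) (*-comm (toℕ α) d) ⟩
      (d * toℕ α) % N             ≡⟨ *-congˡ-% d N (ιinv-% α) ⟨
      (d * ιinv α) % N            ∎) ⟨
    (m * d * ιinv β) % N      ∎
    where
    β : Fin M
    β = (toℕ ((d * toℕ α) mod N) / d) mod M

module RootsOfUnity {c ℓ : Level} (K : CommutativeRing c ℓ)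
                    (N : ℕ) .{{_ : NonZero N}} (ζ : CommutativeRing.Carrier K)
                    (ζ-primitive : Series.IsPrimitiveRoot K N ζ) where
  open CommutativeRing K
  open Series K using (pow)
  open Series.Maps K ζ N using (ζ^)
  open import Algebra.Properties.Semiring.Exp semiring using (_^_; ^-homo-*; ^-assocʳ; ^-congˡ)
  open import Algebra.Properties.CommutativeSemiring.Exp commutativeSemiring using (^-distrib-*)
  open import Algebra.Properties.CommutativeSemigroup *-commutativeSemigroup
    using (interchange; x∙yz≈y∙xz)
  open import Data.Nat.DivMod using (_%_; _/_; m≡m%n+[m/n]*n; m%n<n)
  open import Data.Nat.Divisibility using (n∣m⇒m%n≡0; m%n≡0⇒n∣m)
  import Data.Integer as ℤ
  open import Relation.Binary.Reasoning.Setoid setoid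

  -- ζ ^ (-k), spelled as in 𝓕σ and 𝓕dσ so that it matches them definitionally
  ζ⁻ : ℕ → Carrier
  ζ⁻ k = ζ^ (ℤ.- ℤ.+ k)

  pow≡^ : ∀ x n → pow x n ≡.≡ x ^ n
  pow≡^ x zero    = ≡.refl
  pow≡^ x (suc n) = ≡.cong (x *_) (pow≡^ x n)

  1^n≈1 : ∀ n → 1# ^ n ≈ 1#
  1^n≈1 zero    = refl
  1^n≈1 (suc n) = trans (*-identityˡ _) (1^n≈1 n)

  ζ^-% : ∀ a → ζ ^ a ≈ ζ ^ (a % N)
  ζ^-% a = begin
    ζ ^ a                           ≡⟨ ≡.cong (ζ ^_) (m≡m%n+[m/n]*n a N) ⟩
    ζ ^ (a % N ℕ.+ a / N ℕ.* N)     ≡⟨ ≡.cong (λ e → ζ ^ (a % N ℕ.+ e)) (ℕ.*-comm (a / N) N) ⟩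
    ζ ^ (a % N ℕ.+ N ℕ.* (a / N))   ≈⟨ ^-homo-* ζ (a % N) _ ⟩
    ζ ^ (a % N) * ζ ^ (N ℕ.* (a / N)) ≈⟨ *-congˡ (^-assocʳ ζ N (a / N)) ⟨
    ζ ^ (a % N) * (ζ ^ N) ^ (a / N) ≈⟨ *-congˡ (trans (^-congˡ (a / N) ζᴺ≈1) (1^n≈1 (a / N))) ⟩
    ζ ^ (a % N) * 1#                ≈⟨ *-identityʳ _ ⟩
    ζ ^ (a % N)                     ∎
    where
    ζᴺ≈1 : ζ ^ N ≈ 1#
    ζᴺ≈1 = ≡.subst (_≈ 1#) (pow≡^ ζ N) (proj₁ ζ-primitive)

  ζ⁻-inverse : ∀ k → ζ⁻ k * ζ ^ k ≈ 1#
  ζ⁻-inverse k = begin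
    ζ⁻ k * ζ ^ k        ≡⟨ ≡.cong (_* ζ ^ k) (pow≡^ ζ r) ⟩
    ζ ^ r * ζ ^ k       ≈⟨ ^-homo-* ζ r k ⟨
    ζ ^ (r ℕ.+ k)       ≈⟨ ζ^-% (r ℕ.+ k) ⟩
    ζ ^ ((r ℕ.+ k) % N) ≡⟨ ≡.cong (ζ ^_) (Residues.[-k%ℕn+k]%n≡0 k N) ⟩
    1#                  ∎
    where
    r : ℕ
    r = (ℤ.- ℤ.+ k) ℤ.%ℕ N

  ζ⁻-unique : ∀ {x} k → x * ζ ^ k ≈ 1# → x ≈ ζ⁻ k
  ζ⁻-unique {x} k xζᵏ≈1 = begin
    x                     ≈⟨ *-identityʳ x ⟨
    x * 1#                ≈⟨ *-congˡ (ζ⁻-inverse k) ⟨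
    x * (ζ⁻ k * ζ ^ k)    ≈⟨ x∙yz≈y∙xz x (ζ⁻ k) (ζ ^ k) ⟩
    ζ⁻ k * (x * ζ ^ k)    ≈⟨ *-congˡ xζᵏ≈1 ⟩
    ζ⁻ k * 1#             ≈⟨ *-identityʳ (ζ⁻ k) ⟩
    ζ⁻ k                  ∎

  ζ⁻-cong-% : ∀ {a b} → a % N ≡.≡ b % N → ζ⁻ a ≈ ζ⁻ b
  ζ⁻-cong-% {a} {b} eq = sym (ζ⁻-unique a (begin
    ζ⁻ b * ζ ^ a        ≈⟨ *-congˡ (ζ^-% a) ⟩
    ζ⁻ b * ζ ^ (a % N)  ≡⟨ ≡.cong (λ e → ζ⁻ b * ζ ^ e) eq ⟩
    ζ⁻ b * ζ ^ (b % N)  ≈⟨ *-congˡ (ζ^-% b) ⟨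
    ζ⁻ b * ζ ^ b        ≈⟨ ζ⁻-inverse b ⟩
    1#                  ∎))

  ζ⁻-+ : ∀ a b → ζ⁻ (a ℕ.+ b) ≈ ζ⁻ a * ζ⁻ b
  ζ⁻-+ a b = sym (ζ⁻-unique (a ℕ.+ b) (begin
    (ζ⁻ a * ζ⁻ b) * ζ ^ (a ℕ.+ b)         ≈⟨ *-congˡ (^-homo-* ζ a b) ⟩
    (ζ⁻ a * ζ⁻ b) * (ζ ^ a * ζ ^ b)       ≈⟨ interchange _ _ _ _ ⟩
    (ζ⁻ a * ζ ^ a) * (ζ⁻ b * ζ ^ b)       ≈⟨ *-cong (ζ⁻-inverse a) (ζ⁻-inverse b) ⟩
    1# * 1#                               ≈⟨ *-identityˡ 1# ⟩
    1#                                    ∎))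

  ζ⁻-^ : ∀ a t → ζ⁻ a ^ t ≈ ζ⁻ (a ℕ.* t)
  ζ⁻-^ a t = ζ⁻-unique (a ℕ.* t) (begin
    ζ⁻ a ^ t * ζ ^ (a ℕ.* t)    ≈⟨ *-congˡ (^-assocʳ ζ a t) ⟨
    ζ⁻ a ^ t * (ζ ^ a) ^ t      ≈⟨ ^-distrib-* (ζ⁻ a) (ζ ^ a) t ⟨
    (ζ⁻ a * ζ ^ a) ^ t          ≈⟨ ^-congˡ t (ζ⁻-inverse a) ⟩
    1# ^ t                      ≈⟨ 1^n≈1 t ⟩
    1#                          ∎)

  N∣⇒ζ⁻≈1 : ∀ {a} → N ∣ a → ζ⁻ a ≈ 1#
  N∣⇒ζ⁻≈1 {a} N∣a = sym (ζ⁻-unique a (begin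
    1# * ζ ^ a        ≈⟨ *-identityˡ _ ⟩
    ζ ^ a             ≈⟨ ζ^-% a ⟩
    ζ ^ (a % N)       ≡⟨ ≡.cong (ζ ^_) (n∣m⇒m%n≡0 a N N∣a) ⟩
    1#                ∎))

  ζ⁻≈1⇒N∣ : ∀ {a} → ζ⁻ a ≈ 1# → N ∣ a
  ζ⁻≈1⇒N∣ {a} ζ⁻ᵃ≈1 = m%n≡0⇒n∣m a N (primitive-exponent (a % N) (m%n<n a N) (begin
    ζ ^ (a % N)   ≈⟨ ζ^-% a ⟨
    ζ ^ a         ≈⟨ *-identityˡ _ ⟨
    1# * ζ ^ a    ≈⟨ *-congʳ ζ⁻ᵃ≈1 ⟨
    ζ⁻ a * ζ ^ a  ≈⟨ ζ⁻-inverse a ⟩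
    1#            ∎))
    where
    primitive-exponent : ∀ k → k ℕ.< N → ζ ^ k ≈ 1# → k ≡.≡ 0
    primitive-exponent zero    _   _     = ≡.refl
    primitive-exponent (suc k) k<N ζᵏ≈1 =
      ⊥-elim (proj₂ ζ-primitive (suc k) ℕ.z<s k<N
                (≡.subst (_≈ 1#) (≡.sym (pow≡^ ζ (suc k))) ζᵏ≈1))

module KroneckerDelta {c ℓ : Level} (K : CommutativeRing c ℓ)
                      (ζ : CommutativeRing.Carrier K) (N : ℕ) .{{_ : NonZero N}} where
  open CommutativeRing K
  open Series K using (sumL)
  open Series.Maps K ζ N using (δ)
  open FiniteSums K using (sumL-allAlph-single)
  open import Relation.Binary.Reasoning.Setoid setoid

  δ-diag : ∀ {n} (a : Alph n) v → δ a a v ≡.≡ v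
  δ-diag x₀     v = ≡.refl
  δ-diag x[ i ] v with i Fin.≟ i
  ... | yes _   = ≡.refl
  ... | no  i≢i = ⊥-elim (i≢i ≡.refl)

  δ-off : ∀ {n} {a b : Alph n} v → a ≡.≢ b → δ a b v ≡.≡ 0#
  δ-off {a = x₀}     {x₀}     v a≢b = ⊥-elim (a≢b ≡.refl)
  δ-off {a = x₀}     {x[ _ ]} v a≢b = ≡.refl
  δ-off {a = x[ _ ]} {x₀}     v a≢b = ≡.refl
  δ-off {a = x[ i ]} {x[ j ]} v a≢b with i Fin.≟ j
  ... | yes i≡j = ⊥-elim (a≢b (≡.cong x[_] i≡j))
  ... | no  _   = ≡.refl

  δ-scale : ∀ {n} (a b : Alph n) v → δ a b v ≈ v * δ a b 1#
  δ-scale x₀     x₀     v = sym (*-identityʳ v)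
  δ-scale x₀     x[ _ ] v = sym (zeroʳ v)
  δ-scale x[ _ ] x₀     v = sym (zeroʳ v)
  δ-scale x[ i ] x[ j ] v with i Fin.≟ j
  ... | yes _ = sym (*-identityʳ v)
  ... | no  _ = sym (zeroʳ v)

  sumL-δ : ∀ {n} (a : Alph n) v (τ : Alph n → Carrier) →
           sumL (allAlph n) (λ b → δ a b v * τ b) ≈ v * τ a
  sumL-δ a v τ = begin
    sumL (allAlph _) (λ b → δ a b v * τ b) ≈⟨ sumL-allAlph-single a _ off-diagonal ⟩
    δ a a v * τ a                           ≡⟨ ≡.cong (_* τ a) (δ-diag a v) ⟩
    v * τ a                                 ∎
    where
    off-diagonal : ∀ b → b ≡.≢ a → δ a b v * τ b ≈ 0#
    off-diagonal b b≢a = trans (*-congʳ (reflexive (δ-off v (b≢a ∘ ≡.sym)))) (zeroˡ _)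

module Letters {c ℓ : Level} (K : CommutativeRing c ℓ) (isField : Series.IsField K)
               (M d : ℕ) .{{_ : NonZero M}} .{{_ : NonZero d}} (ζ : CommutativeRing.Carrier K)
               (ζ-primitive : Series.IsPrimitiveRoot K (M ℕ.* d) ζ) where
  open QuotientResidues M d
  open CommutativeRing K
  open Series K
  open Maps ζ N
  open Div d M
  open FiniteSums K
  open Substitution K using (compose)
  open RootsOfUnity K N ζ ζ-primitive
  open KroneckerDelta K ζ N
  open import Algebra.Properties.Semiring.Exp semiring using (_^_)
  open import Data.Nat.DivMod using (_mod_)
  open import Relation.Binary.Reasoning.Setoid setoid

  𝓕-row : ∀ {B : Set} α (c : B) (τ : Alph N → B → Carrier) →
          compose (allAlph N) 𝓕σ τ x[ α ] c ≈
          Σ1to N (λ m → ζ⁻ (m ℕ.* ιinv α) * τ x[ m mod N ] c)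
  𝓕-row α c τ = begin
    sumL (allAlph N) (λ b → Σ1to N (λ m → δ x[ m mod N ] b (ζ⁻ (m ℕ.* ιinv α))) * τ b c)
      ≈⟨ sumL-cong (allAlph N) (λ b → Σ1to-*ʳ N (τ b c) _) ⟩
    sumL (allAlph N) (λ b → Σ1to N (λ m → δ x[ m mod N ] b (ζ⁻ (m ℕ.* ιinv α)) * τ b c))
      ≈⟨ sumL-Σ1to (allAlph N) N _ ⟩
    Σ1to N (λ m → sumL (allAlph N) (λ b → δ x[ m mod N ] b (ζ⁻ (m ℕ.* ιinv α)) * τ b c))
      ≈⟨ Σ1to-cong N (λ m → sumL-δ x[ m mod N ] _ (λ b → τ b c)) ⟩
    Σ1to N (λ m → ζ⁻ (m ℕ.* ιinv α) * τ x[ m mod N ] c) ∎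

  𝓕dσ-row : ∀ β c →
            𝓕dσ x[ β ] c ≈ Σ1to M (λ m → ζ⁻ (m ℕ.* d ℕ.* ιinv β) * δ x[ m mod M ] c 1#)
  𝓕dσ-row β c = Σ1to-cong M (λ m → δ-scale x[ m mod M ] c _)

  p̃σ-∣ : ∀ α → d ∣ toℕ α → ∀ b → p̃σ x[ α ] b ≡.≡ δ x[ νinv α ] b (natK d)
  p̃σ-∣ α d∣α b with d ∣? toℕ α
  ... | yes _   = ≡.refl
  ... | no  d∤α = ⊥-elim (d∤α d∣α)

  p̃σ-∤ : ∀ α → ¬ d ∣ toℕ α → ∀ b → p̃σ x[ α ] b ≡.≡ 0#
  p̃σ-∤ α d∤α b with d ∣? toℕ α
  ... | yes d∣α = ⊥-elim (d∤α d∣α)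
  ... | no  _   = ≡.refl

  iσ-∣ : ∀ k → d ∣ toℕ k → ∀ b → iσ x[ k ] b ≡.≡ δ x[ (toℕ k / d) mod M ] b 1#
  iσ-∣ k d∣k b with d ∣? toℕ k
  ... | yes _   = ≡.refl
  ... | no  d∤k = ⊥-elim (d∤k d∣k)

  iσ-∤ : ∀ k → ¬ d ∣ toℕ k → ∀ b → iσ x[ k ] b ≡.≡ 0#
  iσ-∤ k d∤k b with d ∣? toℕ k
  ... | yes d∣k = ⊥-elim (d∤k d∣k)
  ... | no  _   = ≡.refl

  p*𝓕-row : ∀ α c →
            compose (allAlph N) 𝓕σ pσ x[ α ] c ≈
            geometricSum (ζ⁻ (M ℕ.* ιinv α)) d *
              Σ1to M (λ m → ζ⁻ (m ℕ.* ιinv α) * δ x[ m mod M ] c 1#)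
  p*𝓕-row α c = begin
    compose (allAlph N) 𝓕σ pσ x[ α ] c
      ≈⟨ 𝓕-row α c pσ ⟩
    Σ1to N (λ m → ζ⁻ (m ℕ.* ιinv α) * pσ x[ m mod N ] c)
      ≈⟨ Σ1to-cong N (λ m → reflexive (≡.cong (λ j → ζ⁻ (m ℕ.* ιinv α) * δ x[ j ] c 1#) (mod-N-mod-M m))) ⟩
    Σ1to (M ℕ.* d) f
      ≡⟨ ≡.cong (λ n → Σ1to n f) (ℕ.*-comm M d) ⟩
    Σ1to (d ℕ.* M) f
      ≈⟨ Σ1to-quasiperiodic M d r f f-shift ⟩
    geometricSum r d * Σ1to M f ∎
    where
    r : Carrier
    r = ζ⁻ (M ℕ.* ιinv α)
    f : ℕ → Carrier
    f m = ζ⁻ (m ℕ.* ιinv α) * δ x[ m mod M ] c 1#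
    f-shift : ∀ m → f (M ℕ.+ m) ≈ r * f m
    f-shift m = begin
      ζ⁻ ((M ℕ.+ m) ℕ.* ιinv α) * δ x[ (M ℕ.+ m) mod M ] c 1#
        ≡⟨ ≡.cong₂ (λ e j → ζ⁻ e * δ x[ j ] c 1#) (ℕ.*-distribʳ-+ (ιinv α) M m) (M+-mod-M m) ⟩
      ζ⁻ (M ℕ.* ιinv α ℕ.+ m ℕ.* ιinv α) * δ x[ m mod M ] c 1#
        ≈⟨ *-congʳ (ζ⁻-+ (M ℕ.* ιinv α) (m ℕ.* ιinv α)) ⟩
      (r * ζ⁻ (m ℕ.* ιinv α)) * δ x[ m mod M ] c 1#
        ≈⟨ *-assoc _ _ _ ⟩
      r * f m ∎

  p̃*𝓕d-row-∣ : ∀ α c → d ∣ toℕ α →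
               compose (allAlph M) p̃σ 𝓕dσ x[ α ] c ≈
               natK d * Σ1to M (λ m → ζ⁻ (m ℕ.* ιinv α) * δ x[ m mod M ] c 1#)
  p̃*𝓕d-row-∣ α c d∣α = begin
    sumL (allAlph M) (λ b → p̃σ x[ α ] b * 𝓕dσ b c)
      ≈⟨ sumL-cong (allAlph M) (λ b → *-congʳ (reflexive (p̃σ-∣ α d∣α b))) ⟩
    sumL (allAlph M) (λ b → δ x[ νinv α ] b (natK d) * 𝓕dσ b c)
      ≈⟨ sumL-δ x[ νinv α ] (natK d) (λ b → 𝓕dσ b c) ⟩
    natK d * 𝓕dσ x[ νinv α ] c
      ≈⟨ *-congˡ (𝓕dσ-row (νinv α) c) ⟩
    natK d * Σ1to M (λ m → ζ⁻ (m ℕ.* d ℕ.* ιinv (νinv α)) * δ x[ m mod M ] c 1#)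
      ≈⟨ *-congˡ (Σ1to-cong M (λ m → *-congʳ (ζ⁻-cong-% (νinv-exponent α d∣α m)))) ⟨
    natK d * Σ1to M (λ m → ζ⁻ (m ℕ.* ιinv α) * δ x[ m mod M ] c 1#) ∎

  p̃*𝓕d-row-∤ : ∀ α c → ¬ d ∣ toℕ α → compose (allAlph M) p̃σ 𝓕dσ x[ α ] c ≈ 0#
  p̃*𝓕d-row-∤ α c d∤α =
    sumL-zero (allAlph M) (λ b → trans (*-congʳ (reflexive (p̃σ-∤ α d∤α b))) (zeroˡ _))

  p*𝓕≈𝓕dp̃* : ∀ a c → compose (allAlph N) 𝓕σ pσ a c ≈ compose (allAlph M) p̃σ 𝓕dσ a c
  p*𝓕≈𝓕dp̃* x₀ c = begin
    compose (allAlph N) 𝓕σ pσ x₀ c   ≈⟨ sumL-δ x₀ 1# (λ b → pσ b c) ⟩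
    1# * δ x₀ c (natK d)             ≈⟨ *-identityˡ _ ⟩
    δ x₀ c (natK d)                  ≈⟨ δ-scale x₀ c (natK d) ⟩
    natK d * 𝓕dσ x₀ c                ≈⟨ sumL-δ x₀ (natK d) (λ b → 𝓕dσ b c) ⟨
    compose (allAlph M) p̃σ 𝓕dσ x₀ c  ∎
  p*𝓕≈𝓕dp̃* x[ α ] c = by-cases (d ∣? toℕ α)
    where
    r : Carrier
    r = ζ⁻ (M ℕ.* ιinv α)
    by-cases : Dec (d ∣ toℕ α) →
               compose (allAlph N) 𝓕σ pσ x[ α ] c ≈ compose (allAlph M) p̃σ 𝓕dσ x[ α ] c
    by-cases (yes d∣α) = begin
      compose (allAlph N) 𝓕σ pσ x[ α ] c  ≈⟨ p*𝓕-row α c ⟩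
      geometricSum r d * _                ≈⟨ *-congʳ (geometricSum-one d r≈1) ⟩
      natK d * _                          ≈⟨ p̃*𝓕d-row-∣ α c d∣α ⟨
      compose (allAlph M) p̃σ 𝓕dσ x[ α ] c ∎
      where
      r≈1 : r ≈ 1#
      r≈1 = N∣⇒ζ⁻≈1 (d∣⇒N∣M*ιinv α d∣α)
    by-cases (no d∤α) = begin
      compose (allAlph N) 𝓕σ pσ x[ α ] c  ≈⟨ p*𝓕-row α c ⟩
      geometricSum r d * _                ≈⟨ *-congʳ (geometricSum-root isField d r≉1 rᵈ≈1) ⟩
      0# * _                              ≈⟨ zeroˡ _ ⟩
      0#                                  ≈⟨ p̃*𝓕d-row-∤ α c d∤α ⟨
      compose (allAlph M) p̃σ 𝓕dσ x[ α ] c ∎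
      where
      r≉1 : ¬ r ≈ 1#
      r≉1 = d∤α ∘ N∣M*ιinv⇒d∣ α ∘ ζ⁻≈1⇒N∣
      rᵈ≈1 : r ^ d ≈ 1#
      rᵈ≈1 = trans (ζ⁻-^ (M ℕ.* ιinv α) d) (N∣⇒ζ⁻≈1 (N∣M*x*d (ιinv α)))

  i*𝓕≈𝓕dĩ* : ∀ a c → compose (allAlph N) 𝓕σ iσ a c ≈ compose (allAlph M) ĩσ 𝓕dσ a c
  i*𝓕≈𝓕dĩ* x₀ c = trans (sumL-δ x₀ 1# (λ b → iσ b c)) (sym (sumL-δ x₀ 1# (λ b → 𝓕dσ b c)))
  i*𝓕≈𝓕dĩ* x[ α ] c = begin
    compose (allAlph N) 𝓕σ iσ x[ α ] c
      ≈⟨ 𝓕-row α c iσ ⟩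
    Σ1to (M ℕ.* d) F
      ≈⟨ Σ1to-multiples d M F F-vanishes ⟩
    Σ1to M (λ m → F (d ℕ.* m))
      ≈⟨ Σ1to-cong M F-multiple ⟩
    Σ1to M (λ m → ζ⁻ (m ℕ.* d ℕ.* ιinv β) * δ x[ m mod M ] c 1#)
      ≈⟨ 𝓕dσ-row β c ⟨
    𝓕dσ x[ β ] c
      ≈⟨ *-identityˡ _ ⟨
    1# * 𝓕dσ x[ β ] c
      ≈⟨ sumL-δ x[ β ] 1# (λ b → 𝓕dσ b c) ⟨
    compose (allAlph M) ĩσ 𝓕dσ x[ α ] c ∎
    where
    β : Fin M
    β = νinv ((d ℕ.* toℕ α) mod N)
    F : ℕ → Carrier
    F m = ζ⁻ (m ℕ.* ιinv α) * iσ x[ m mod N ] c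
    F-vanishes : ∀ m → ¬ d ∣ m → F m ≈ 0#
    F-vanishes m d∤m =
      trans (*-congˡ (reflexive (iσ-∤ (m mod N) (d∤m ∘ d∣-mod-N) c))) (zeroʳ _)
    F-multiple : ∀ m → F (d ℕ.* m) ≈ ζ⁻ (m ℕ.* d ℕ.* ιinv β) * δ x[ m mod M ] c 1#
    F-multiple m = *-cong (ζ⁻-cong-% (νinv-d*-exponent α m)) (reflexive (≡.trans
      (iσ-∣ ((d ℕ.* m) mod N) (d∣-d*-mod-N m) c)
      (≡.cong (λ j → δ x[ j ] c 1#) (d*-mod-N-div m))))

lemmaA4 : {c ℓ : Level} (K : CommutativeRing c ℓ) → Series.IsField K →
  (N : ℕ) .{{_ : NonZero N}} → 3 ≤ N →
  (ζ : CommutativeRing.Carrier K) → Series.IsPrimitiveRoot K N ζ →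
  (d : ℕ) .{{_ : NonZero d}} → (d∣N : d ∣ N) →
  let open Series K
      open Maps ζ N
      open Div d (quotient d∣N) {{quotient≢0 d∣N}}
  in ((S : Ser (Alph N)) → p* (𝓕 S) ≈S 𝓕d (p̃* S))
     × ((S : Ser (Alph N)) → i* (𝓕 S) ≈S 𝓕d (ĩ* S))
lemmaA4 K isField _ _ ζ ζ-primitive d d∣N@(divides M ≡.refl) =
  subst-square (allAlph (M ℕ.* d)) (allAlph (M ℕ.* d)) (allAlph M) p*𝓕≈𝓕dp̃* ,
  subst-square (allAlph (M ℕ.* d)) (allAlph (M ℕ.* d)) (allAlph M) i*𝓕≈𝓕dĩ*
  where
  open Substitution K using (subst-square)
  open Letters K isField M d {{quotient≢0 d∣N}} ζ ζ-primitive
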